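{- Let $G_1$ be a reduced graph (as defined in the context). Then there exists a maximum path-cycle cover of $G_1$ in which every path component of length at most $2$ has an endpoint that is adjacent, via an edge of $G_1$, to a vertex not belonging to that path component.
   Context: Throughout, $G_1$ is a connected undirected simple graph which is not a tree and which is reduced, meaning: (R1) every edge of $G_1$ whose two ends are each adjacent to a leaf (degree-$1$ vertex) of $G_1$ is a cut edge of $G_1$; (R2) no cut vertex of $G_1$ adjacent to a leaf of $G_1$ is super (a cut vertex is super if deleting it increases the number of connected components by at least $2$). Moreover it is assumed that no maximum path-cycle cover of $G_1$ consists of a single connected component. A path-cycle cover of $G_1$ is a spanning subgraph in which every vertex has degree at most $2$; it is maximum if it has the maximum number of edges among all path-cycle covers. Its connected components are path components and cycle components; the length of a path is its number of edges; a path of length $0$ is a singleton. A vertex of a path component is inner if its degree in the path is $2$ and an endpoint otherwise (the endpoint of a singleton is the singleton vertex itself). -}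

module Defs where

open import Data.Nat using (ℕ; zero; suc; _+_; _≤_; _<_)
open import Data.Fin using (Fin; zero; suc; inject₁; fromℕ; _<?_)
open import Data.Bool using (Bool; true; false; T; _∧_; if_then_else_)
open import Data.Product using (Σ; ∃; _×_; _,_)
open import Data.Sum using (_⊎_)
open import Data.Unit using (⊤)
open import Data.Empty using (⊥)
open import Relation.Nullary using (¬_)
open import Relation.Nullary.Decidable using (⌊_⌋)
open import Relation.Binary.PropositionalEquality using (_≡_; _≢_)

record SimpleGraph (n : ℕ) : Set where
  field
    adj    : Fin n → Fin n → Bool
    sym    : ∀ i j → adj i j ≡ adj j i
    irrefl : ∀ i → adj i i ≡ false
open SimpleGraph public

Rel : ℕ → Set₁
Rel n = Fin n → Fin n → Set

E : ∀ {n} → (Fin n → Fin n → Bool) → Rel n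
E A i j = T (A i j)

data Reach {n : ℕ} (R : Rel n) : Fin n → Fin n → Set where
  here : ∀ {x} → Reach R x x
  step : ∀ {x y z} → R x y → Reach R y z → Reach R x z

count : ∀ {n} → (Fin n → Bool) → ℕ
count {zero}  f = 0
count {suc n} f = (if f zero then 1 else 0) + count (λ i → f (suc i))

sumFin : ∀ {n} → (Fin n → ℕ) → ℕ
sumFin {zero}  f = 0
sumFin {suc n} f = f zero + sumFin (λ i → f (suc i))

deg : ∀ {n} → (Fin n → Fin n → Bool) → Fin n → ℕ
deg A v = count (A v)

edgeCount : ∀ {n} → (Fin n → Fin n → Bool) → ℕ
edgeCount A = sumFin (λ i → count (λ j → A i j ∧ ⌊ i <? j ⌋))

Connected : ∀ {n} → SimpleGraph n → Set
Connected G = ∀ u v → Reach (E (adj G)) u v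

HasCycle : ∀ {n} → SimpleGraph n → Set
HasCycle {n} G =
  Σ ℕ λ m → (2 ≤ m) × Σ (Fin (suc m) → Fin n) λ f →
    (∀ i j → f i ≡ f j → i ≡ j) ×
    (∀ (i : Fin m) → E (adj G) (f (inject₁ i)) (f (suc i))) ×
    E (adj G) (f (fromℕ m)) (f zero)

IsTree : ∀ {n} → SimpleGraph n → Set
IsTree G = Connected G × ¬ HasCycle G

-- "the graph (alive vertices, edge relation R) has at least k connected components":
-- there are k alive vertices, pairwise not connected
AtLeastComps : ∀ {n} → (Fin n → Set) → Rel n → ℕ → Set
AtLeastComps {n} alive R k =
  Σ (Fin k → Fin n) λ f → (∀ i → alive (f i)) ×
    (∀ i j → i ≢ j → ¬ Reach R (f i) (f j))

compsG≥ : ∀ {n} → SimpleGraph n → ℕ → Set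
compsG≥ G k = AtLeastComps (λ _ → ⊤) (E (adj G)) k

delV-alive : ∀ {n} → Fin n → Fin n → Set
delV-alive v x = x ≢ v

delV-rel : ∀ {n} → SimpleGraph n → Fin n → Rel n
delV-rel G v x y = E (adj G) x y × x ≢ v × y ≢ v

delE-rel : ∀ {n} → SimpleGraph n → Fin n → Fin n → Rel n
delE-rel G a b x y = E (adj G) x y × ¬ ((x ≡ a × y ≡ b) ⊎ (x ≡ b × y ≡ a))

-- c(G - e) > c(G)
CutEdge : ∀ {n} → SimpleGraph n → Fin n → Fin n → Set
CutEdge G a b = E (adj G) a b ×
  (∀ k → compsG≥ G k → AtLeastComps (λ _ → ⊤) (delE-rel G a b) (suc k))

-- c(G - v) > c(G)
CutVertex : ∀ {n} → SimpleGraph n → Fin n → Set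
CutVertex G v = ∀ k → compsG≥ G k → AtLeastComps (delV-alive v) (delV-rel G v) (suc k)

-- c(G - v) ≥ c(G) + 2
SuperCutVertex : ∀ {n} → SimpleGraph n → Fin n → Set
SuperCutVertex G v = CutVertex G v ×
  (∀ k → compsG≥ G k → AtLeastComps (delV-alive v) (delV-rel G v) (suc (suc k)))

Leaf : ∀ {n} → SimpleGraph n → Fin n → Set
Leaf G v = deg (adj G) v ≡ 1

AdjToLeaf : ∀ {n} → SimpleGraph n → Fin n → Set
AdjToLeaf G v = ∃ λ l → Leaf G l × E (adj G) v l

R1 : ∀ {n} → SimpleGraph n → Set
R1 G = ∀ u v → E (adj G) u v → AdjToLeaf G u → AdjToLeaf G v → CutEdge G u v

R2 : ∀ {n} → SimpleGraph n → Set
R2 G = ∀ v → CutVertex G v → AdjToLeaf G v → ¬ SuperCutVertex G v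

Reduced : ∀ {n} → SimpleGraph n → Set
Reduced G = R1 G × R2 G

record PCC {n : ℕ} (G : SimpleGraph n) : Set where
  field
    H     : Fin n → Fin n → Bool
    H-sym : ∀ i j → H i j ≡ H j i
    H⊆G   : ∀ i j → T (H i j) → T (adj G i j)
    deg≤2 : ∀ v → deg H v ≤ 2
open PCC public

MaximumPCC : ∀ {n} {G : SimpleGraph n} → PCC G → Set
MaximumPCC {G = G} C = ∀ (C' : PCC G) → edgeCount (H C') ≤ edgeCount (H C)

SingleComponent : ∀ {n} {G : SimpleGraph n} → PCC G → Set
SingleComponent C = ∀ u v → Reach (E (H C)) u v

IsPathComponent : ∀ {n} {G : SimpleGraph n} → PCC G → (m : ℕ) → (Fin (suc m) → Fin n) → Set
IsPathComponent {n} C m f =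
  (∀ i j → f i ≡ f j → i ≡ j) ×
  (∀ (i : Fin m) → E (H C) (f (inject₁ i)) (f (suc i))) ×
  (∀ i j → E (H C) (f i) (f j) →
     Σ (Fin m) λ k → (inject₁ k ≡ i × suc k ≡ j) ⊎ (inject₁ k ≡ j × suc k ≡ i)) ×
  (∀ i (w : Fin n) → E (H C) (f i) w → ∃ λ j → f j ≡ w)

InPath : ∀ {n m} → (Fin (suc m) → Fin n) → Fin n → Set
InPath f w = ∃ λ j → f j ≡ w

-- Since a graph has finitely many path-cycle covers, a maximum one C exists. As G is connected and
-- C is not a single component, some vertex of every path component has a G-neighbour outside it;
-- on a path of length at most 1 every vertex is an endpoint. On a path a — b — c whose ends have
-- no outside neighbour, ac ∉ G by maximality, so a and c are pendant at b; the outside neighbour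
-- of b then lies in a third component of G - b, making b a super cut vertex adjacent to the leaf a,
-- which R2 forbids.
module Submission where

open import Defs hiding (sym)
open import Data.Nat using (ℕ; zero; suc; _+_; _≤_; _<_; z≤n; s≤s; _≤?_)
open import Data.Nat.Properties
  using (≤-refl; ≤-trans; ≤-reflexive; ≤-antisym; m≤m+n; m≤n+m; +-identityʳ; module ≤-Reasoning; +-mono-≤; +-mono-<-≤; +-mono-≤-<; <⇒≱; +-commutativeSemigroup)
open import Data.Fin as Fin using (Fin; zero; suc; inject₁; inject≤; fromℕ; _<?_)
import Data.Fin.Properties as Finₚ
open import Data.Fin.Properties using (_≟_; any?; all?; suc-injective; fromℕ≢inject₁; inject≤-injective; 0≢1+n)
open import Data.Vec.Functional as Vector using (Vector; head; tail)
open import Data.Bool using (Bool; true; false; T; _∧_; _∨_; if_then_else_)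
open import Data.Bool.Properties using (T-∧; T-∨; T?) renaming (_≟_ to _≟ᵇ_)
open import Data.Product using (Σ; ∃; _×_; _,_; proj₁; proj₂)
import Data.Product as Product
open import Data.Sum using (_⊎_; inj₁; inj₂)
import Data.Sum as Sum
open import Data.Unit using (tt)
open import Data.Empty using (⊥; ⊥-elim)
open import Data.Maybe using (Maybe; just; nothing)
open import Data.Maybe.Relation.Unary.Any as MaybeAny using (just)
open import Data.List using (List; []; _∷_; [_]; mapMaybe; cartesianProductWith)
open import Data.List.Relation.Unary.Any using (Any; here; there)
open import Data.List.Relation.Unary.Any.Properties using (cartesianProductWith⁺; mapMaybe⁺; gmap)
open import Data.List.Extrema.Nat using (argmax; v≤f[argmax]⁺)
open import Algebra.Properties.CommutativeSemigroup +-commutativeSemigroup using (interchange)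
open import Function using (_∘_; mk⇔; Equivalence)
open import Relation.Nullary using (¬_; Dec; yes; no; does)
open import Relation.Nullary.Decidable using (⌊_⌋; _×-dec_; _⊎-dec_; _→-dec_; ¬?; toWitness; fromWitness; does-⇔; isYes≗does)
open import Relation.Binary using (tri<; tri≈; tri>)
open import Relation.Binary.PropositionalEquality
  using (_≡_; _≢_; _≗_; refl; sym; trans; cong; cong₂; subst; module ≡-Reasoning)

indicator : Bool → ℕ
indicator b = if b then 1 else 0

indicator-mono : ∀ {b c} → (T b → T c) → indicator b ≤ indicator c
indicator-mono {false}        _ = z≤n
indicator-mono {true} {true}  _ = ≤-refl
indicator-mono {true} {false} h = ⊥-elim (h tt)

indicator-mono-< : ∀ {b c} → ¬ T b → T c → indicator b < indicator c
indicator-mono-< {false} {true} _  _ = ≤-refl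
indicator-mono-< {true}         ¬b _ = ⊥-elim (¬b tt)

count-cong : ∀ {n} (f g : Fin n → Bool) → f ≗ g → count f ≡ count g
count-cong {zero}  f g f≗g = refl
count-cong {suc n} f g f≗g =
  cong₂ _+_ (cong indicator (f≗g zero)) (count-cong (f ∘ suc) (g ∘ suc) (f≗g ∘ suc))

count-mono : ∀ {n} (f g : Fin n → Bool) → (∀ x → T (f x) → T (g x)) → count f ≤ count g
count-mono {zero}  f g f⊆g = z≤n
count-mono {suc n} f g f⊆g =
  +-mono-≤ (indicator-mono (f⊆g zero)) (count-mono (f ∘ suc) (g ∘ suc) (f⊆g ∘ suc))

count-mono-< : ∀ {n} (f g : Fin n → Bool) → (∀ x → T (f x) → T (g x)) →
  ∀ x → ¬ T (f x) → T (g x) → count f < count g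
count-mono-< {suc n} f g f⊆g zero ¬fx gx =
  +-mono-<-≤ (indicator-mono-< ¬fx gx) (count-mono (f ∘ suc) (g ∘ suc) (f⊆g ∘ suc))
count-mono-< {suc n} f g f⊆g (suc x) ¬fx gx =
  +-mono-≤-< (indicator-mono (f⊆g zero)) (count-mono-< (f ∘ suc) (g ∘ suc) (f⊆g ∘ suc) x ¬fx gx)

count-zero : ∀ {n} (f : Fin n → Bool) → (∀ x → ¬ T (f x)) → count f ≡ 0
count-zero {zero}  f ¬f = refl
count-zero {suc n} f ¬f with f zero in eq
... | true  = ⊥-elim (¬f zero (subst T (sym eq) tt))
... | false = count-zero (f ∘ suc) (¬f ∘ suc)

count≤1 : ∀ {n} (f : Fin n → Bool) (p : Fin n) → (∀ x → T (f x) → x ≡ p) → count f ≤ 1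
count≤1 {suc n} f zero    f⊆p = +-mono-≤ (indicator-mono {c = true} _)
  (≤-reflexive (count-zero (f ∘ suc) (λ x fx → 0≢1+n (sym (f⊆p (suc x) fx)))))
count≤1 {suc n} f (suc p) f⊆p with f zero in eq
... | true  = ⊥-elim (0≢1+n (f⊆p zero (subst T (sym eq) tt)))
... | false = count≤1 (f ∘ suc) p (λ x fx → suc-injective (f⊆p (suc x) fx))

count-pos : ∀ {n} (f : Fin n → Bool) (p : Fin n) → T (f p) → 1 ≤ count f
count-pos f zero    fp = ≤-trans (indicator-mono {true} (λ _ → fp)) (m≤m+n _ _)
count-pos f (suc p) fp = ≤-trans (count-pos (f ∘ suc) p fp) (m≤n+m _ _)

count≡1 : ∀ {n} (f : Fin n → Bool) (p : Fin n) → T (f p) → (∀ x → T (f x) → x ≡ p) → count f ≡ 1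
count≡1 f p fp f⊆p = ≤-antisym (count≤1 f p f⊆p) (count-pos f p fp)

count-∨ : ∀ {n} (f g : Fin n → Bool) → count (λ x → f x ∨ g x) ≤ count f + count g
count-∨ {zero}  f g = z≤n
count-∨ {suc n} f g = ≤-trans
  (+-mono-≤ (indicator-∨ (f zero) (g zero)) (count-∨ (f ∘ suc) (g ∘ suc)))
  (≤-reflexive (interchange (indicator (f zero)) (indicator (g zero)) _ _))
  where
  indicator-∨ : ∀ b c → indicator (b ∨ c) ≤ indicator b + indicator c
  indicator-∨ false c = ≤-refl
  indicator-∨ true  c = s≤s z≤n

sumFin-cong : ∀ {n} (f g : Fin n → ℕ) → f ≗ g → sumFin f ≡ sumFin g
sumFin-cong {zero}  f g f≗g = refl
sumFin-cong {suc n} f g f≗g = cong₂ _+_ (f≗g zero) (sumFin-cong (f ∘ suc) (g ∘ suc) (f≗g ∘ suc))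

sumFin-mono : ∀ {n} (f g : Fin n → ℕ) → (∀ x → f x ≤ g x) → sumFin f ≤ sumFin g
sumFin-mono {zero}  f g f≤g = z≤n
sumFin-mono {suc n} f g f≤g = +-mono-≤ (f≤g zero) (sumFin-mono (f ∘ suc) (g ∘ suc) (f≤g ∘ suc))

sumFin-mono-< : ∀ {n} (f g : Fin n → ℕ) → (∀ x → f x ≤ g x) → ∀ x → f x < g x → sumFin f < sumFin g
sumFin-mono-< {suc n} f g f≤g zero    fx<gx = +-mono-<-≤ fx<gx (sumFin-mono (f ∘ suc) (g ∘ suc) (f≤g ∘ suc))
sumFin-mono-< {suc n} f g f≤g (suc x) fx<gx =
  +-mono-≤-< (f≤g zero) (sumFin-mono-< (f ∘ suc) (g ∘ suc) (f≤g ∘ suc) x fx<gx)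

Matrix : ℕ → Set
Matrix n = Fin n → Fin n → Bool

T-∧-monoˡ : ∀ {a b} c → (T a → T b) → T (a ∧ c) → T (b ∧ c)
T-∧-monoˡ {true} {true}  c a⇒b t = t
T-∧-monoˡ {true} {false} c a⇒b t = ⊥-elim (a⇒b tt)

edgeCount-cong : ∀ {n} (A B : Matrix n) → (∀ i → A i ≗ B i) → edgeCount A ≡ edgeCount B
edgeCount-cong A B A≗B =
  sumFin-cong _ _ (λ i → count-cong _ _ (λ j → cong (_∧ ⌊ i <? j ⌋) (A≗B i j)))

edgeCount-mono-< : ∀ {n} (A B : Matrix n) → (∀ i j → T (A i j) → T (B i j)) →
  ∀ {i j} → i Fin.< j → ¬ T (A i j) → T (B i j) → edgeCount A < edgeCount B
edgeCount-mono-< A B A⊆B {i} {j} i<j ¬Aij Bij =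
  sumFin-mono-< _ _ (λ k → count-mono _ _ (row⊆ k)) i
    (count-mono-< _ _ (row⊆ i) j
      (λ t → ¬Aij (proj₁ (Equivalence.to T-∧ t)))
      (Equivalence.from T-∧ (Bij , fromWitness i<j)))
  where
  row⊆ : ∀ k l → T (A k l ∧ ⌊ k <? l ⌋) → T (B k l ∧ ⌊ k <? l ⌋)
  row⊆ k l = T-∧-monoˡ ⌊ k <? l ⌋ (A⊆B k l)

Symmetric : ∀ {n} → Matrix n → Set
Symmetric A = ∀ i j → A i j ≡ A j i

E-sym : ∀ {n} {A : Matrix n} → Symmetric A → ∀ {x y} → E A x y → E A y x
E-sym A-sym {x} {y} = subst T (A-sym x y)

edgeCount-mono-<-sym : ∀ {n} (A B : Matrix n) → Symmetric A → Symmetric B →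
  (∀ i j → T (A i j) → T (B i j)) →
  ∀ {i j} → i ≢ j → ¬ T (A i j) → T (B i j) → edgeCount A < edgeCount B
edgeCount-mono-<-sym A B A-sym B-sym A⊆B {i} {j} i≢j ¬Aij Bij with Finₚ.<-cmp i j
... | tri< i<j _ _ = edgeCount-mono-< A B A⊆B i<j ¬Aij Bij
... | tri≈ _ i≡j _ = ⊥-elim (i≢j i≡j)
... | tri> _ _ j<i = edgeCount-mono-< A B A⊆B j<i (¬Aij ∘ E-sym A-sym) (E-sym B-sym Bij)

module _ {n : ℕ} {R : Rel n} where

  Reach-trans : ∀ {x y z} → Reach R x y → Reach R y z → Reach R x z
  Reach-trans here        yz = yz
  Reach-trans (step r xy) yz = step r (Reach-trans xy yz)

  Reach-sym : (∀ {x y} → R x y → R y x) → ∀ {x y} → Reach R x y → Reach R y x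
  Reach-sym R-sym here        = here
  Reach-sym R-sym (step r xy) = Reach-trans (Reach-sym R-sym xy) (step (R-sym r) here)

  Reach-closed : (S : Fin n → Set) → (∀ {x y} → R x y → S x → S y) →
    ∀ {x y} → Reach R x y → S x → S y
  Reach-closed S S-closed here        Sx = Sx
  Reach-closed S S-closed (step r xy) Sx = Reach-closed S S-closed xy (S-closed r Sx)

  Reach-along : ∀ {m} (f : Fin (suc m) → Fin n) → (∀ (i : Fin m) → R (f (inject₁ i)) (f (suc i))) →
    ∀ j → Reach R (f zero) (f j)
  Reach-along          f steps zero    = here
  Reach-along {suc m}  f steps (suc j) = step (steps zero) (Reach-along (f ∘ suc) (steps ∘ suc) j)

  AtLeastComps-mono : ∀ {alive : Fin n → Set} {k l} → k ≤ l → AtLeastComps alive R l → AtLeastComps alive R k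
  AtLeastComps-mono k≤l (g , g-alive , g-apart) =
    g ∘ (λ i → inject≤ i k≤l) , g-alive ∘ (λ i → inject≤ i k≤l) ,
    λ i j i≢j → g-apart _ _ (i≢j ∘ inject≤-injective k≤l k≤l i j)

module _ {n : ℕ} (G : SimpleGraph n) where

  adj-sym : ∀ {x y} → E (adj G) x y → E (adj G) y x
  adj-sym = E-sym (SimpleGraph.sym G)

  adj-irrefl : ∀ {x} → ¬ E (adj G) x x
  adj-irrefl {x} = subst T (irrefl G x)

  adj⇒≢ : ∀ {x y} → E (adj G) x y → x ≢ y
  adj⇒≢ xy refl = adj-irrefl xy

  connected⇒comps≤1 : Connected G → ∀ k → compsG≥ G k → k ≤ 1
  connected⇒comps≤1 conn zero          _                 = z≤n
  connected⇒comps≤1 conn (suc zero)    _                 = s≤s z≤n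
  connected⇒comps≤1 conn (suc (suc k)) (g , _ , g-apart) = ⊥-elim (g-apart zero (suc zero) (λ ()) (conn _ _))

  connected-closed : Connected G → (S : Fin n → Set) → (∀ {x y} → E (adj G) x y → S x → S y) →
    ∀ {x} → S x → ∀ y → S y
  connected-closed conn S S-closed {x} Sx y = Reach-closed S S-closed (conn x y) Sx

  three-components⇒super : Connected G → ∀ {v} →
    AtLeastComps (delV-alive v) (delV-rel G v) 3 → SuperCutVertex G v
  three-components⇒super conn three =
    (λ k c → AtLeastComps-mono {alive = delV-alive _}
               (s≤s (≤-trans (connected⇒comps≤1 conn k c) (s≤s z≤n))) three) ,
    (λ k c → AtLeastComps-mono {alive = delV-alive _}
               (s≤s (s≤s (connected⇒comps≤1 conn k c))) three)

  pendant-isolated : ∀ {v x y} → (∀ y → E (adj G) x y → y ≡ v) → Reach (delV-rel G v) x y → y ≡ x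
  pendant-isolated x⇒v here                            = refl
  pendant-isolated x⇒v (step {y = y} (xy , _ , y≢v) _) = ⊥-elim (y≢v (x⇒v y xy))

  pendant-apart : ∀ {v x y} → (∀ y → E (adj G) x y → y ≡ v) → y ≢ x →
    ¬ Reach (delV-rel G v) x y × ¬ Reach (delV-rel G v) y x
  pendant-apart x⇒v y≢x =
    y≢x ∘ pendant-isolated x⇒v ,
    y≢x ∘ pendant-isolated x⇒v ∘ Reach-sym (λ (xy , x≢v , y≢v) → adj-sym xy , y≢v , x≢v)

  pendant-pair-components : ∀ {v x z w} → (∀ y → E (adj G) x y → y ≡ v) → (∀ y → E (adj G) z y → y ≡ v) →
    x ≢ v → z ≢ v → w ≢ v → z ≢ x → w ≢ x → w ≢ z →
    AtLeastComps (delV-alive v) (delV-rel G v) 3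
  pendant-pair-components {v} {x} {z} {w} x⇒v z⇒v x≢v z≢v w≢v z≢x w≢x w≢z = g , alive , apart
    where
    g : Fin 3 → Fin n
    g zero             = x
    g (suc zero)       = z
    g (suc (suc zero)) = w
    alive : ∀ i → g i ≢ v
    alive zero             = x≢v
    alive (suc zero)       = z≢v
    alive (suc (suc zero)) = w≢v
    apart : ∀ i j → i ≢ j → ¬ Reach (delV-rel G v) (g i) (g j)
    apart zero             (suc zero)       _ = proj₁ (pendant-apart x⇒v z≢x)
    apart zero             (suc (suc zero)) _ = proj₁ (pendant-apart x⇒v w≢x)
    apart (suc zero)       zero             _ = proj₂ (pendant-apart x⇒v z≢x)
    apart (suc zero)       (suc (suc zero)) _ = proj₁ (pendant-apart z⇒v w≢z)
    apart (suc (suc zero)) zero             _ = proj₂ (pendant-apart x⇒v w≢x)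
    apart (suc (suc zero)) (suc zero)       _ = proj₂ (pendant-apart z⇒v w≢z)
    apart zero             zero             i≢i = ⊥-elim (i≢i refl)
    apart (suc zero)       (suc zero)       i≢i = ⊥-elim (i≢i refl)
    apart (suc (suc zero)) (suc (suc zero)) i≢i = ⊥-elim (i≢i refl)

vectors : ∀ {B : Set} → List B → ∀ k → List (Vector B k)
vectors xs zero    = [ Vector.[] ]
vectors xs (suc k) = cartesianProductWith Vector._∷_ xs (vectors xs k)

vectors-complete : ∀ {B : Set} (_≈_ : B → B → Set) {xs : List B} → (∀ b → Any (b ≈_) xs) →
  ∀ {k} (u : Vector B k) → Any (λ u′ → ∀ i → u i ≈ u′ i) (vectors xs k)
vectors-complete _≈_ xs-complete {zero}  u = here (λ ())
vectors-complete _≈_ xs-complete {suc k} u =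
  cartesianProductWith⁺ Vector._∷_ (λ { h≈ t≈ zero → h≈ ; h≈ t≈ (suc i) → t≈ i })
    (xs-complete (head u)) (vectors-complete _≈_ xs-complete (tail u))

matrices : ∀ n → List (Matrix n)
matrices n = vectors (vectors (true ∷ false ∷ []) n) n

matrices-complete : ∀ {n} (A : Matrix n) → Any (λ B → ∀ i → A i ≗ B i) (matrices n)
matrices-complete A = vectors-complete _≗_ (vectors-complete _≡_ bool-complete) A
  where
  bool-complete : ∀ b → Any (b ≡_) (true ∷ false ∷ [])
  bool-complete true  = here refl
  bool-complete false = there (here refl)

module _ {n : ℕ} (G : SimpleGraph n) where

  IsCover : Matrix n → Set
  IsCover A = Symmetric A × (∀ i j → T (A i j) → T (adj G i j)) × (∀ v → deg A v ≤ 2)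

  isCover? : ∀ A → Dec (IsCover A)
  isCover? A =
    all? (λ i → all? (λ j → A i j ≟ᵇ A j i)) ×-dec
    all? (λ i → all? (λ j → T? (A i j) →-dec T? (adj G i j))) ×-dec
    all? (λ v → deg A v ≤? 2)

  IsCover-resp : ∀ {A B} → (∀ i → A i ≗ B i) → IsCover A → IsCover B
  IsCover-resp {A} {B} A≗B (A-sym , A⊆G , A-deg) =
    (λ i j → trans (sym (A≗B i j)) (trans (A-sym i j) (A≗B j i))) ,
    (λ i j → A⊆G i j ∘ subst T (sym (A≗B i j))) ,
    (λ v → ≤-trans (≤-reflexive (count-cong (B v) (A v) (sym ∘ A≗B v))) (A-deg v))

  toPCC : ∀ {A} → IsCover A → PCC G
  toPCC {A} (A-sym , A⊆G , A-deg) = record { H = A ; H-sym = A-sym ; H⊆G = A⊆G ; deg≤2 = A-deg }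

  emptyPCC : PCC G
  emptyPCC = toPCC {λ _ _ → false}
    ((λ _ _ → refl) , (λ _ _ ()) , (λ v → ≤-trans (≤-reflexive (count-zero {n} (λ _ → false) (λ _ ()))) z≤n))

  fromMatrix : Matrix n → Maybe (PCC G)
  fromMatrix A with isCover? A
  ... | yes isCover = just (toPCC isCover)
  ... | no  _       = nothing

  covers : List (PCC G)
  covers = mapMaybe fromMatrix (matrices n)

  covers-complete : (C : PCC G) → Any (λ C′ → edgeCount (H C) ≤ edgeCount (H C′)) covers
  covers-complete C = mapMaybe⁺ fromMatrix (matrices n) (gmap found (matrices-complete (H C)))
    where
    found : ∀ {A} → (∀ i → H C i ≗ A i) → MaybeAny.Any (λ C′ → edgeCount (H C) ≤ edgeCount (H C′)) (fromMatrix A)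
    found {A} C≗A with isCover? A
    ... | yes _        = just (≤-reflexive (edgeCount-cong (H C) A C≗A))
    ... | no ¬isCover = ⊥-elim (¬isCover (IsCover-resp C≗A (H-sym C , H⊆G C , deg≤2 C)))

  maximumPCC-exists : Σ (PCC G) MaximumPCC
  maximumPCC-exists =
    argmax (edgeCount ∘ H) emptyPCC covers ,
    λ C → v≤f[argmax]⁺ emptyPCC covers (inj₂ (covers-complete C))

Link : ∀ {n} → Fin n → Fin n → Fin n → Fin n → Set
Link a c v x = (v ≡ a × x ≡ c) ⊎ (v ≡ c × x ≡ a)

link? : ∀ {n} (a c v x : Fin n) → Dec (Link a c v x)
link? a c v x = (v ≟ a ×-dec x ≟ c) ⊎-dec (v ≟ c ×-dec x ≟ a)

link : ∀ {n} → Fin n → Fin n → Matrix n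
link a c v x = ⌊ link? a c v x ⌋

link-sym : ∀ {n} (a c : Fin n) → Symmetric (link a c)
link-sym a c v x = begin
  ⌊ link? a c v x ⌋   ≡⟨ isYes≗does (link? a c v x) ⟩
  does (link? a c v x) ≡⟨ does-⇔ (mk⇔ flip flip) (link? a c v x) (link? a c x v) ⟩
  does (link? a c x v) ≡⟨ isYes≗does (link? a c x v) ⟨
  ⌊ link? a c x v ⌋   ∎
  where
  open ≡-Reasoning
  flip : ∀ {v x} → Link a c v x → Link a c x v
  flip = Sum.swap ∘ Sum.map Product.swap Product.swap

deg-link-outside : ∀ {n} (a c v : Fin n) → v ≢ a → v ≢ c → deg (link a c) v ≡ 0
deg-link-outside a c v v≢a v≢c = count-zero (link a c v) (λ x t → Sum.[ v≢a ∘ proj₁ , v≢c ∘ proj₁ ] (toWitness t))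

deg-link-left : ∀ {n} (a c : Fin n) → deg (link a c) a ≤ 1
deg-link-left a c = count≤1 (link a c a) c
  (λ x t → Sum.[ proj₂ , (λ (a≡c , x≡a) → trans x≡a a≡c) ] (toWitness t))

deg-link-right : ∀ {n} (a c : Fin n) → deg (link a c) c ≤ 1
deg-link-right a c = count≤1 (link a c c) a
  (λ x t → Sum.[ (λ (c≡a , x≡c) → trans x≡c c≡a) , proj₂ ] (toWitness t))

module _ {n : ℕ} {G : SimpleGraph n} (C : PCC G) {a c : Fin n} (ac : E (adj G) a c)
  (a-deg : deg (H C) a ≤ 1) (c-deg : deg (H C) c ≤ 1) where

  addEdge : PCC G
  addEdge = record { H = H′ ; H-sym = H′-sym ; H⊆G = H′⊆G ; deg≤2 = H′-deg }
    where
    H′ : Matrix n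
    H′ v x = H C v x ∨ link a c v x

    H′-sym : Symmetric H′
    H′-sym v x = cong₂ _∨_ (H-sym C v x) (link-sym a c v x)

    H′⊆G : ∀ v x → T (H′ v x) → T (adj G v x)
    H′⊆G v x t with Equivalence.to T-∨ t
    ... | inj₁ h = H⊆G C v x h
    ... | inj₂ l with toWitness l
    ...   | inj₁ (refl , refl) = ac
    ...   | inj₂ (refl , refl) = adj-sym G ac

    H′-deg : ∀ v → deg H′ v ≤ 2
    H′-deg v = ≤-trans (count-∨ (H C v) (link a c v)) (split (v ≟ a) (v ≟ c))
      where
      split : Dec (v ≡ a) → Dec (v ≡ c) → deg (H C) v + deg (link a c) v ≤ 2
      split (yes refl) _ = +-mono-≤ a-deg (deg-link-left a c)
      split (no _) (yes refl) = +-mono-≤ c-deg (deg-link-right a c)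
      split (no v≢a) (no v≢c) = begin
        deg (H C) v + deg (link a c) v ≡⟨ cong (deg (H C) v +_) (deg-link-outside a c v v≢a v≢c) ⟩
        deg (H C) v + 0                ≡⟨ +-identityʳ _ ⟩
        deg (H C) v                    ≤⟨ deg≤2 C v ⟩
        2                              ∎
        where open ≤-Reasoning

  addEdge-grows : ¬ E (H C) a c → edgeCount (H C) < edgeCount (H addEdge)
  addEdge-grows ¬ac = edgeCount-mono-<-sym (H C) (H addEdge) (H-sym C) (H-sym addEdge)
    (λ v x h → Equivalence.from T-∨ (inj₁ h)) (adj⇒≢ G ac) ¬ac
    (Equivalence.from (T-∨ {H C a c}) (inj₂ (fromWitness {a? = link? a c a c} (inj₁ (refl , refl)))))

maximum-saturated : ∀ {n} {G : SimpleGraph n} {C : PCC G} → MaximumPCC C →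
  ∀ {a c} → E (adj G) a c → deg (H C) a ≤ 1 → deg (H C) c ≤ 1 → E (H C) a c
maximum-saturated {C = C} maximum {a} {c} ac a-deg c-deg with T? (H C a c)
... | yes C-ac = C-ac
... | no ¬C-ac = ⊥-elim (<⇒≱ (addEdge-grows C ac a-deg c-deg ¬C-ac) (maximum (addEdge C ac a-deg c-deg)))

NeighbourOutside : ∀ {n m} → SimpleGraph n → (Fin (suc m) → Fin n) → Fin n → Set
NeighbourOutside G f e = ∃ λ w → ¬ InPath f w × E (adj G) e w

inPath? : ∀ {n m} (f : Fin (suc m) → Fin n) w → Dec (InPath f w)
inPath? f w = any? (λ j → f j ≟ w)

neighbourOutside? : ∀ {n m} (G : SimpleGraph n) (f : Fin (suc m) → Fin n) e → Dec (NeighbourOutside G f e)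
neighbourOutside? G f e = any? (λ w → ¬? (inPath? f w) ×-dec T? (adj G e w))

neighbours-inside : ∀ {n m} {G : SimpleGraph n} {f : Fin (suc m) → Fin n} {e w} →
  ¬ NeighbourOutside G f e → E (adj G) e w → InPath f w
neighbours-inside {f = f} {w = w} ¬out ew with inPath? f w
... | yes w∈f = w∈f
... | no  w∉f = ⊥-elim (¬out (w , w∉f , ew))

module _ {n : ℕ} {G : SimpleGraph n} {C : PCC G} {m : ℕ} {f : Fin (suc m) → Fin n} where

  pathComponent-reach : IsPathComponent C m f → ∀ i j → Reach (E (H C)) (f i) (f j)
  pathComponent-reach (_ , steps , _ , _) i j =
    Reach-trans (Reach-sym (E-sym (H-sym C)) (Reach-along f steps i)) (Reach-along f steps j)

  spanning-pathComponent⇒single : IsPathComponent C m f → (∀ u → InPath f u) → SingleComponent C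
  spanning-pathComponent⇒single pc spanning u v with spanning u | spanning v
  ... | i , refl | j , refl = pathComponent-reach pc i j

module _ {n : ℕ} {G : SimpleGraph n} {C : PCC G} {m : ℕ} {f : Fin (suc (suc m)) → Fin n}
  (pc : IsPathComponent C (suc m) f) where

  pathComponent-first : ∀ {x} → E (H C) (f zero) x → x ≡ f (suc zero)
  pathComponent-first {x} e with proj₂ (proj₂ (proj₂ pc)) zero x e
  ... | j , refl with proj₁ (proj₂ (proj₂ pc)) zero j e
  ...   | zero  , inj₁ (_ , refl) = refl
  ...   | suc _ , inj₁ (() , _)
  ...   | _     , inj₂ (_ , ())

  pathComponent-last : ∀ {x} → E (H C) (f (fromℕ (suc m))) x → x ≡ f (inject₁ (fromℕ m))
  pathComponent-last {x} e with proj₂ (proj₂ (proj₂ pc)) (fromℕ (suc m)) x e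
  ... | j , refl with proj₁ (proj₂ (proj₂ pc)) (fromℕ (suc m)) j e
  ...   | k , inj₁ (k≡last , _)  = ⊥-elim (fromℕ≢inject₁ (sym k≡last))
  ...   | k , inj₂ (k≡j , k+1≡last) = cong f (trans (sym k≡j) (cong inject₁ (suc-injective k+1≡last)))

EndpointExits : ∀ {n} → SimpleGraph n → ∀ m → (Fin (suc m) → Fin n) → Set
EndpointExits G m f = ∃ λ e → (e ≡ f zero ⊎ e ≡ f (fromℕ m)) × NeighbourOutside G f e

module _ {n : ℕ} {G : SimpleGraph n} (conn : Connected G) (r2 : R2 G)
  {C : PCC G} (maximum : MaximumPCC C) (notSingle : ¬ SingleComponent C) where

  some-vertex-exits : ∀ {m} f → IsPathComponent C m f → ∃ λ i → NeighbourOutside G f (f i)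
  some-vertex-exits f pc with any? (λ i → neighbourOutside? G f (f i))
  ... | yes exit = exit
  ... | no ¬exit = ⊥-elim (notSingle (spanning-pathComponent⇒single {C = C} {f = f} pc
                     (connected-closed G conn (InPath f) closed (zero , refl))))
    where
    closed : ∀ {x y} → E (adj G) x y → InPath f x → InPath f y
    closed xy (i , refl) = neighbours-inside {G = G} {f = f} (λ out → ¬exit (i , out)) xy

  closed-ends-impossible : ∀ {f : Fin 3 → Fin n} → IsPathComponent C 2 f →
    ¬ NeighbourOutside G f (f zero) → ¬ NeighbourOutside G f (f (suc (suc zero))) → ⊥
  closed-ends-impossible {f} pc ¬a-out ¬c-out with some-vertex-exits f pc
  ... | zero           , a-out = ¬a-out a-out
  ... | suc (suc zero) , c-out = ¬c-out c-out
  ... | suc zero       , (w , w∉f , bw) = r2 b (proj₁ b-super) (a , a-leaf , adj-sym G ab) b-super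
    where
    a b c : Fin n
    a = f zero
    b = f (suc zero)
    c = f (suc (suc zero))

    distinct : ∀ {i j} → i ≢ j → f i ≢ f j
    distinct i≢j = i≢j ∘ proj₁ pc _ _

    outside : ∀ i → w ≢ f i
    outside i w≡fi = w∉f (i , sym w≡fi)

    ab : E (adj G) a b
    ab = H⊆G C a b (proj₁ (proj₂ pc) zero)

    a-end : ∀ {x} → E (H C) a x → x ≡ b
    a-end = pathComponent-first {C = C} {f = f} pc

    c-end : ∀ {x} → E (H C) c x → x ≡ b
    c-end = pathComponent-last {C = C} {f = f} pc

    ¬ac : ¬ E (adj G) a c
    ¬ac ac = distinct (λ ()) (a-end (maximum-saturated {C = C} maximum ac
      (count≤1 _ b (λ _ → a-end)) (count≤1 _ b (λ _ → c-end))))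

    a-pendant : ∀ y → E (adj G) a y → y ≡ b
    a-pendant y ay with neighbours-inside {G = G} {f = f} {w = y} ¬a-out ay
    ... | zero           , refl = ⊥-elim (adj-irrefl G ay)
    ... | suc zero       , refl = refl
    ... | suc (suc zero) , refl = ⊥-elim (¬ac ay)

    c-pendant : ∀ y → E (adj G) c y → y ≡ b
    c-pendant y cy with neighbours-inside {G = G} {f = f} {w = y} ¬c-out cy
    ... | zero           , refl = ⊥-elim (¬ac (adj-sym G cy))
    ... | suc zero       , refl = refl
    ... | suc (suc zero) , refl = ⊥-elim (adj-irrefl G cy)

    a-leaf : Leaf G a
    a-leaf = count≡1 (adj G a) b ab a-pendant

    b-super : SuperCutVertex G b
    b-super = three-components⇒super G conn
      (pendant-pair-components G a-pendant c-pendant (distinct (λ ())) (distinct (λ ())) (outside (suc zero))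
        (distinct (λ ())) (outside zero) (outside (suc (suc zero))))

  short-path-endpoint-exits : ∀ m f → m ≤ 2 → IsPathComponent C m f → EndpointExits G m f
  short-path-endpoint-exits zero f _ pc with some-vertex-exits f pc
  ... | zero , out = f zero , inj₁ refl , out
  short-path-endpoint-exits (suc zero) f _ pc with some-vertex-exits f pc
  ... | zero     , out = f zero , inj₁ refl , out
  ... | suc zero , out = f (suc zero) , inj₂ refl , out
  short-path-endpoint-exits (suc (suc zero)) f _ pc
    with neighbourOutside? G f (f zero) | neighbourOutside? G f (f (suc (suc zero)))
  ... | yes out | _       = f zero , inj₁ refl , out
  ... | no _    | yes out = f (suc (suc zero)) , inj₂ refl , out
  ... | no ¬a-out | no ¬c-out = ⊥-elim (closed-ends-impossible pc ¬a-out ¬c-out)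
  short-path-endpoint-exits (suc (suc (suc m))) f (s≤s (s≤s ())) pc

lemma6 : ∀ {n} (G : SimpleGraph n) → Connected G → ¬ IsTree G → Reduced G →
    (∀ (C : PCC G) → MaximumPCC C → ¬ SingleComponent C) →
    Σ (PCC G) λ C → MaximumPCC C ×
    (∀ (m : ℕ) (f : Fin (suc m) → Fin n) → m ≤ 2 → IsPathComponent C m f →
    ∃ λ e → (e ≡ f zero ⊎ e ≡ f (fromℕ m)) ×
    ∃ λ w → ¬ InPath f w × E (adj G) e w)
lemma6 G conn _ (_ , r2) notSingle =
  C , maximum , short-path-endpoint-exits conn r2 {C = C} maximum (notSingle C maximum)
  where
  C : PCC G
  C = proj₁ (maximumPCC-exists G)
  maximum : MaximumPCC C
  maximum = proj₂ (maximumPCC-exists G)
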